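{- $\theta_f(\overline{M_{22}})\le 22/6$.
   Context: The Mesner graph $M_{22}$ has as vertices the $77$ blocks of the Steiner system $S(3,6,22)$ (the unique family of $6$-subsets of $\{1,\dots,22\}$ such that every $3$-subset lies in exactly one block), two blocks being adjacent iff they are disjoint; $\overline{M_{22}}$ is its complement. $\theta_f(G)$, the fractional clique covering number, is the fractional chromatic number $\chi_f(\overline{G})=\inf_b\chi_b(\overline{G})/b$ of the complement, where $\chi_b$ is the least number of colours in an assignment of $b$-element colour sets to vertices with adjacent vertices receiving disjoint sets. -}

module Defs where

open import Data.Nat using (ℕ; suc)
open import Data.Fin using (Fin)
open import Data.Fin.Subset using (Subset; _⊆_; _∩_; ∣_∣; Empty)
open import Data.Integer using (+_)
open import Data.Rational using (ℚ; _/_; _≤_)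
open import Data.Product using (_×_; Σ; ∃!)
open import Relation.Binary.PropositionalEquality using (_≡_; _≢_)
open import Relation.Nullary using (¬_)

Graph : ℕ → Set₁
Graph n = Fin n → Fin n → Set

complement : ∀ {n} → Graph n → Graph n
complement G i j = (i ≢ j) × ¬ G i j

Disjoint : ∀ {m} → Subset m → Subset m → Set
Disjoint p q = Empty (p ∩ q)

Colouring : ∀ {n} → Graph n → (b c : ℕ) → Set
Colouring {n} G b c =
  Σ (Fin n → Subset c) λ col →
    ((i : Fin n) → ∣ col i ∣ ≡ b) ×
    ((i j : Fin n) → G i j → Disjoint (col i) (col j))

-- χ_f(G) ≤ q, where χ_f(G) = inf_{b ≥ 1} χ_b(G)/b: every rational r that
-- is a lower bound of all c/b (b ≥ 1, G has a b-fold colouring with c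
-- colours) satisfies r ≤ q.
FracChromaticLE : ∀ {n} → Graph n → ℚ → Set
FracChromaticLE G q =
  (r : ℚ) →
  ((k c : ℕ) → Colouring G (suc k) c → r ≤ (+ c) / suc k) →
  r ≤ q

FracCliqueCoverLE : ∀ {n} → Graph n → ℚ → Set
FracCliqueCoverLE G q = FracChromaticLE (complement G) q

IsSteiner3-6-22 : ∀ {n} → (Fin n → Subset 22) → Set
IsSteiner3-6-22 {n} B =
  ((i : Fin n) → ∣ B i ∣ ≡ 6) ×
  ((i j : Fin n) → B i ≡ B j → i ≡ j) ×
  ((T : Subset 22) → ∣ T ∣ ≡ 3 → ∃! _≡_ (λ i → T ⊆ B i))

Mesner : ∀ {n} → (Fin n → Subset 22) → Graph n
Mesner B i j = Disjoint (B i) (B j)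

{-# OPTIONS --safe #-}
module Submission where

-- Since θ_f(complement M) = χ_f(M), it suffices to colour M₂₂ itself: giving
-- every block its own six points as colour set is a 6-fold colouring with 22
-- colours, as disjoint blocks receive disjoint colour sets.

open import Defs
open import Data.Nat using (ℕ; suc)
open import Data.Fin using (Fin)
open import Data.Fin.Subset using (Subset; ∣_∣)
open import Data.Integer using (+_)
open import Data.Rational using (_/_)
open import Data.Product using (_,_)
open import Relation.Binary.PropositionalEquality using (_≡_)
open import Relation.Nullary.Negation using (Stable; negated-stable)

complement²⇒ : ∀ {n} {G : Graph n} → (∀ i j → Stable (G i j)) →
               ∀ i j → complement (complement G) i j → G i j
complement²⇒ stable i j (i≢j , ¬co) = stable i j (λ ¬g → ¬co (i≢j , ¬g))

colouring-⊆ : ∀ {n b c} {G H : Graph n} → (∀ i j → H i j → G i j) →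
              Colouring G b c → Colouring H b c
colouring-⊆ H⊆G (col , size , disjoint) =
  col , size , λ i j h → disjoint i j (H⊆G i j h)

colouring⇒fracChromaticLE : ∀ {n k c} {G : Graph n} →
                            Colouring G (suc k) c → FracChromaticLE G ((+ c) / suc k)
colouring⇒fracChromaticLE {k = k} {c} col r lowerBound = lowerBound k c col

mesner-blockColouring : ∀ {n b} (B : Fin n → Subset 22) →
                        (∀ i → ∣ B i ∣ ≡ b) → Colouring (Mesner B) b 22
mesner-blockColouring B blockSize = B , blockSize , λ i j disjoint → disjoint

theorem3p15 : (n : ℕ) (B : Fin n → Subset 22) → IsSteiner3-6-22 B →
    FracCliqueCoverLE (complement (Mesner B)) ((+ 22) / 6)
theorem3p15 n B (blockSize , _ , _) =
  colouring⇒fracChromaticLE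
    (colouring-⊆ (complement²⇒ (λ _ _ → negated-stable))
                 (mesner-blockColouring B blockSize))
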